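{- Let $\mathbf c$ be a linear order on $c_1,\dots,c_t$ ($t\ge1$). (1) For every $i\in\{1,\dots,t+1\}$, the number of vertices of $\mathscr G(\mathbf c)$ with label $i$ is a power of $2$. (2) For every $i\in\{1,\dots,t\}$, the number of edges of $\mathscr G(\mathbf c)$ with label $i$ is a power of $2$.
   Context: Let $T=\{1,\dots,t\}$. A linear order $\mathbf c$ on symbols $c_1,\dots,c_t$ determines a labelled graph $\mathscr G(\mathbf c)$ (vertices labelled in $\{1,\dots,t+1\}$, edges labelled in $T$), defined inductively. For $t=1$: two vertices labelled $1$ and $2$ joined by an edge labelled $1$. For $t\ge2$: let $c_s$ be the maximal element of $\mathbf c$. Let $\mathbf c'$ be the induced order on $\mathbf c\setminus\{c_s\}$, reindexed by keeping indices $<s$ and decreasing indices $>s$ by $1$; let $\mathscr G'=\mathscr G(\mathbf c')$. Let $\mathscr G^+$ be a copy of $\mathscr G'$ in which every label (on vertices and edges) $\ell\le s-1$ is kept and every label $\ell\ge s$ is replaced by $\ell+1$. Let $\mathscr G^-$ be a second copy of the same underlying graph, with $\varphi:\mathscr G^+\to\mathscr G^-$ the identification, carrying the same labels except that vertices labelled $s+1$ in $\mathscr G^+$ are labelled $s$ in $\mathscr G^-$. Then $\mathscr G(\mathbf c)$ is the disjoint union of $\mathscr G^+$ and $\mathscr G^-$ together with, for each vertex $v$ of $\mathscr G^+$ of label $s+1$, an edge labelled $s$ joining $v$ and $\varphi(v)$. -}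

module Defs where

open import Data.Nat using (ℕ; zero; suc; _+_; _≤_; _≤ᵇ_; _≡ᵇ_; _^_)
open import Data.Bool using (Bool; true; false; if_then_else_)
import Data.Fin
import Data.Sum
open import Data.Fin using (Fin; toℕ; fromℕ; _↑ˡ_; _↑ʳ_)
open import Data.Fin.Permutation using (Permutation′; _⟨$⟩ˡ_; remove)
open import Data.List using (List; []; _∷_; map; filter; length; _++_; allFin)
open import Data.Product using (_×_; _,_; proj₁; proj₂; ∃)
open import Relation.Binary.PropositionalEquality using (_≡_)
open import Data.Nat using (_≟_)

-- A linear order c on the symbols c_1,…,c_t is encoded by its rank
-- permutation π : Fin t ↔ Fin t :  c_{i+1} < c_{j+1}  iff  π i < π j
-- (Fin is 0-based; the symbol c_{i+1} corresponds to i : Fin t).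
LinOrder : ℕ → Set
LinOrder t = Permutation′ t

record LGraph : Set where
  constructor mkLGraph
  field
    nV     : ℕ
    vlabel : Fin nV → ℕ
    edges  : List (Fin nV × Fin nV × ℕ)
open LGraph public

shiftLabel : ℕ → ℕ → ℕ
shiftLabel s ℓ = if suc ℓ ≤ᵇ s then ℓ else suc ℓ

-- labels of G⁻: as in G⁺ except that label s+1 becomes s
minusLabel : ℕ → ℕ → ℕ
minusLabel s ℓ = if ℓ ≡ᵇ suc s then s else ℓ

-- The doubling step: from G' = 𝒢(c') and the (1-based) index s of the
-- maximal element, build 𝒢(c) = G⁺ ⊔ G⁻ ⊔ {new edges labelled s}.
double : ℕ → LGraph → LGraph
double s (mkLGraph n vl es) = mkLGraph (n + n) vl′ es′
  where
  vl⁺ : Fin n → ℕ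
  vl⁺ v = shiftLabel s (vl v)
  vl⁻ : Fin n → ℕ
  vl⁻ v = minusLabel s (vl⁺ v)
  vl′ : Fin (n + n) → ℕ
  vl′ w with Data.Fin.splitAt n w
  ... | Data.Sum.inj₁ v = vl⁺ v
  ... | Data.Sum.inj₂ v = vl⁻ v
  e⁺ : Fin n × Fin n × ℕ → Fin (n + n) × Fin (n + n) × ℕ
  e⁺ (a , b , ℓ) = (a ↑ˡ n) , (b ↑ˡ n) , shiftLabel s ℓ
  e⁻ : Fin n × Fin n × ℕ → Fin (n + n) × Fin (n + n) × ℕ
  e⁻ (a , b , ℓ) = (n ↑ʳ a) , (n ↑ʳ b) , shiftLabel s ℓ
  new : Fin n → Fin (n + n) × Fin (n + n) × ℕ
  new v = (v ↑ˡ n) , (n ↑ʳ v) , s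
  es′ : List (Fin (n + n) × Fin (n + n) × ℕ)
  es′ = map e⁺ es ++ map e⁻ es
          ++ map new (filter (λ v → vl⁺ v ≟ suc s) (allFin n))

-- 𝒢(c) for a linear order on t+1 symbols (t ≥ 0), i.e. the paper's t+1.
𝒢 : (t : ℕ) → LinOrder (suc t) → LGraph
𝒢 zero    c = mkLGraph 2 lab ((Data.Fin.zero , Data.Fin.suc Data.Fin.zero , 1) ∷ [])
  where
  lab : Fin 2 → ℕ
  lab Data.Fin.zero = 1
  lab (Data.Fin.suc _) = 2
𝒢 (suc t) c = double (suc (toℕ s)) (𝒢 t (remove s c))
  where
  -- the maximal element: the symbol of largest rank
  s : Fin (suc (suc t))
  s = c ⟨$⟩ˡ fromℕ (suc t)

vertexCount : LGraph → ℕ → ℕ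
vertexCount G i = length (filter (λ v → vlabel G v ≟ i) (allFin (nV G)))

edgeCount : LGraph → ℕ → ℕ
edgeCount G i = length (filter (λ e → proj₂ (proj₂ e) ≟ i) (edges G))

IsPowerOf2 : ℕ → Set
IsPowerOf2 m = ∃ λ k → m ≡ 2 ^ k

module Submission where

-- The proof is an induction along the recursive construction 𝒢(c) =
-- double s 𝒢(c′).  In the doubled graph the vertices with label i are those
-- of G⁺ with label i together with those of G⁻ with label i; their labels are
-- obtained from the labels of G′ by the maps  shift = shiftLabel s  and
-- minus ∘ shift.  Each of these maps hits a given label i either exactly at one
-- label a (we call this a fibre) or not at all, so each half contributes
-- either the count of label a in G′ or zero.  Working through the positions of
-- i relative to s, the count of label i in the doubled graph is always N + N,
-- N + 0 or 0 + N for a count N of G′, which is a power of two by induction.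
-- Edges are handled in the same way: both copies carry shifted labels, and
-- the new edges (all labelled s) are in bijection with the vertices of G⁺
-- labelled s + 1, i.e. with the vertices of G′ labelled s.

open import Defs
open import Data.Nat using (ℕ; suc; _≤_)
open import Data.Product using (_×_)

open import Data.Nat using (zero; _+_; _<_; _^_; _≤ᵇ_; _≡ᵇ_; z≤n; s≤s; _≟_)
open import Data.Nat.Properties
open import Data.Bool using (true; false; T)
open import Data.Unit using (tt)
open import Data.Empty using (⊥-elim)
open import Data.Sum using (_⊎_; inj₁; inj₂)
open import Data.Product using (_,_; proj₁; proj₂)
open import Data.Fin using (Fin; fromℕ; _↑ˡ_; _↑ʳ_)
open import Data.Fin.Permutation using (remove; _⟨$⟩ˡ_)
open import Data.Fin.Properties using (splitAt-↑ˡ; splitAt-↑ʳ; toℕ<n)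
open import Data.List using (List; []; _∷_; map; filter; length; _++_; allFin; tabulate)
open import Data.List.Properties using (map-tabulate; length-++; filter-++; filter-≐; filter-none; filter-all)
open import Data.List.Relation.Unary.All using (universal)
open import Relation.Nullary using (¬_)
open import Relation.Binary.PropositionalEquality
open import Relation.Binary.Definitions using (tri<; tri≈; tri>)
open import Function using (_∘_; id)

private
  variable
    A B : Set
    f g : A → ℕ
    i j a : ℕ

count : List A → (A → ℕ) → ℕ → ℕ
count xs f i = length (filter (λ x → f x ≟ i) xs)

count-++ : (xs ys : List A) → count (xs ++ ys) f i ≡ count xs f i + count ys f i
count-++ {f = f} {i = i} xs ys =
  trans (cong length (filter-++ (λ x → f x ≟ i) xs ys)) (length-++ (filter _ xs))

count-map : (h : B → A) (xs : List B) → count (map h xs) f i ≡ count xs (f ∘ h) i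
count-map h [] = refl
count-map {f = f} {i = i} h (x ∷ xs) with f (h x) ≡ᵇ i
... | true  = cong suc (count-map h xs)
... | false = count-map h xs

count-≐ : (xs : List A) → (∀ x → f x ≡ i → g x ≡ j) → (∀ x → g x ≡ j → f x ≡ i) →
          count xs f i ≡ count xs g j
count-≐ xs to from = cong length (filter-≐ _ _ ((λ {x} → to x) , (λ {x} → from x)) xs)

count-none : (xs : List A) → (∀ x → ¬ f x ≡ i) → count xs f i ≡ 0
count-none xs never = cong length (filter-none _ (universal never xs))

count-all : (xs : List A) → (∀ x → f x ≡ i) → count xs f i ≡ length xs
count-all xs always = cong length (filter-all _ (universal always xs))

Fibre : (ℕ → ℕ) → ℕ → ℕ → Set
Fibre h i a = h a ≡ i × (∀ y → h y ≡ i → y ≡ a)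

Missed : (ℕ → ℕ) → ℕ → Set
Missed h i = ∀ y → ¬ h y ≡ i

count-fibre : ∀ {h : ℕ → ℕ} (xs : List A) → Fibre h i a → count xs (h ∘ f) i ≡ count xs f a
count-fibre {f = f} {h = h} xs (ha≡i , only-a) =
  count-≐ xs (λ x → only-a (f x)) (λ x fx≡a → trans (cong h fx≡a) ha≡i)

count-missed : ∀ {h : ℕ → ℕ} (xs : List A) → Missed h i → count xs (h ∘ f) i ≡ 0
count-missed {f = f} xs missed = count-none xs (λ x → missed (f x))

fibre-∘ : ∀ {h k : ℕ → ℕ} {b} → Fibre h i a → Fibre k a b → Fibre (h ∘ k) i b
fibre-∘ {h = h} (ha≡i , only-a) (kb≡a , only-b) =
  trans (cong h kb≡a) ha≡i , λ y hky≡i → only-b y (only-a _ hky≡i)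

shift-cases : ∀ s y → (y < s × shiftLabel s y ≡ y) ⊎ (s ≤ y × shiftLabel s y ≡ suc y)
shift-cases s y with suc y ≤ᵇ s in eq
... | true  = inj₁ (≤ᵇ⇒≤ (suc y) s (subst T (sym eq) tt) , refl)
... | false = inj₂ (≮⇒≥ (λ y<s → subst T eq (≤⇒≤ᵇ y<s)) , refl)

minus-cases : ∀ s z → (z ≡ suc s × minusLabel s z ≡ s) ⊎ (¬ z ≡ suc s × minusLabel s z ≡ z)
minus-cases s z with z ≡ᵇ suc s in eq
... | true  = inj₁ (≡ᵇ⇒≡ z (suc s) (subst T (sym eq) tt) , refl)
... | false = inj₂ ((λ z≡s+1 → subst T eq (≡⇒≡ᵇ z (suc s) z≡s+1)) , refl)

shift-fibre-below : ∀ {s} → i < s → Fibre (shiftLabel s) i i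
shift-fibre-below {i} {s} i<s with shift-cases s i
... | inj₁ (_ , shift-i) = shift-i , only-i
  where
  only-i : ∀ y → shiftLabel s y ≡ i → y ≡ i
  only-i y e with shift-cases s y
  ... | inj₁ (_ , shift-y) = trans (sym shift-y) e
  ... | inj₂ (s≤y , shift-y) = ⊥-elim (<-irrefl refl (<-trans i<s (≤-trans (s≤s s≤y) (≤-reflexive (trans (sym shift-y) e)))))
... | inj₂ (s≤i , _) = ⊥-elim (<-irrefl refl (<-≤-trans i<s s≤i))

shift-fibre-above : ∀ {s} → s ≤ j → Fibre (shiftLabel s) (suc j) j
shift-fibre-above {j} {s} s≤j with shift-cases s j
... | inj₁ (j<s , _) = ⊥-elim (<-irrefl refl (<-≤-trans j<s s≤j))
... | inj₂ (_ , shift-j) = shift-j , only-j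
  where
  only-j : ∀ y → shiftLabel s y ≡ suc j → y ≡ j
  only-j y e with shift-cases s y
  ... | inj₁ (y<s , shift-y) = ⊥-elim (<-irrefl (trans (sym shift-y) e) (<-≤-trans y<s (≤-trans s≤j (n≤1+n j))))
  ... | inj₂ (_ , shift-y) = suc-injective (trans (sym shift-y) e)

shift-missed : ∀ s → Missed (shiftLabel s) s
shift-missed s y e with shift-cases s y
... | inj₁ (y<s , shift-y) = <-irrefl (trans (sym shift-y) e) y<s
... | inj₂ (s≤y , shift-y) = <-irrefl refl (≤-trans (s≤s s≤y) (≤-reflexive (trans (sym shift-y) e)))

minus-fibre-fixed : ∀ {s} → ¬ i ≡ s → ¬ i ≡ suc s → Fibre (minusLabel s) i i
minus-fibre-fixed {i} {s} i≢s i≢s+1 with minus-cases s i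
... | inj₁ (i≡s+1 , _) = ⊥-elim (i≢s+1 i≡s+1)
... | inj₂ (_ , minus-i) = minus-i , only-i
  where
  only-i : ∀ z → minusLabel s z ≡ i → z ≡ i
  only-i z e with minus-cases s z
  ... | inj₁ (_ , minus-z) = ⊥-elim (i≢s (trans (sym e) minus-z))
  ... | inj₂ (_ , minus-z) = trans (sym minus-z) e

minus-missed : ∀ s → Missed (minusLabel s) (suc s)
minus-missed s z e with minus-cases s z
... | inj₁ (_ , minus-z) = <-irrefl (trans (sym minus-z) e) ≤-refl
... | inj₂ (z≢s+1 , minus-z) = z≢s+1 (trans (sym minus-z) e)

-- in G⁻ the label s comes exactly from the label s of G′ (through s + 1)
lower-fibre-at : ∀ s → Fibre (minusLabel s ∘ shiftLabel s) s s
lower-fibre-at s = lower-s , only-s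
  where
  shift-s : shiftLabel s s ≡ suc s
  shift-s = proj₁ (shift-fibre-above ≤-refl)
  lower-s : minusLabel s (shiftLabel s s) ≡ s
  lower-s with minus-cases s (shiftLabel s s)
  ... | inj₁ (_ , minus-z) = minus-z
  ... | inj₂ (z≢s+1 , _) = ⊥-elim (z≢s+1 shift-s)
  only-s : ∀ y → minusLabel s (shiftLabel s y) ≡ s → y ≡ s
  only-s y e with minus-cases s (shiftLabel s y)
  ... | inj₁ (z≡s+1 , _) = proj₂ (shift-fibre-above ≤-refl) y z≡s+1
  ... | inj₂ (_ , minus-z) = ⊥-elim (shift-missed s y (trans (sym minus-z) e))

allFin-+ : ∀ m {n} → allFin (m + n) ≡ map (_↑ˡ n) (allFin m) ++ map (m ↑ʳ_) (allFin n)
allFin-+ m {n} = trans (tabulate-split m id) (cong₂ _++_ (sym (map-tabulate id (_↑ˡ n))) (sym (map-tabulate id (m ↑ʳ_))))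
  where
  tabulate-split : ∀ {C : Set} m (h : Fin (m + n) → C) →
                   tabulate h ≡ tabulate (h ∘ (_↑ˡ n)) ++ tabulate (h ∘ (m ↑ʳ_))
  tabulate-split zero h = refl
  tabulate-split (suc m) h = cong (h Data.Fin.zero ∷_) (tabulate-split m (h ∘ Data.Fin.suc))

edgeLabel : ∀ {V : Set} → V × V × ℕ → ℕ
edgeLabel e = proj₂ (proj₂ e)

newEdgeSources : ℕ → (H : LGraph) → List (Fin (nV H))
newEdgeSources s H = filter (λ v → shiftLabel s (vlabel H v) ≟ suc s) (allFin (nV H))

module _ (s : ℕ) (H : LGraph) where
  private
    n : ℕ
    n = nV H

  vertexCount-double : ∀ i → vertexCount (double s H) i ≡
    count (allFin n) (shiftLabel s ∘ vlabel H) i + count (allFin n) (minusLabel s ∘ shiftLabel s ∘ vlabel H) i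
  vertexCount-double i = begin
    vertexCount (double s H) i
      ≡⟨ cong (λ vs → count vs (vlabel (double s H)) i) (allFin-+ n) ⟩
    count (map (_↑ˡ n) (allFin n) ++ map (n ↑ʳ_) (allFin n)) (vlabel (double s H)) i
      ≡⟨ count-++ (map (_↑ˡ n) (allFin n)) _ ⟩
    count (map (_↑ˡ n) (allFin n)) (vlabel (double s H)) i + count (map (n ↑ʳ_) (allFin n)) (vlabel (double s H)) i
      ≡⟨ cong₂ _+_ (trans (count-map _ (allFin n)) (count-≐ (allFin n) (λ v → subst (_≡ i) (upper v)) (λ v → subst (_≡ i) (sym (upper v)))))
                   (trans (count-map _ (allFin n)) (count-≐ (allFin n) (λ v → subst (_≡ i) (lower v)) (λ v → subst (_≡ i) (sym (lower v))))) ⟩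
    count (allFin n) (shiftLabel s ∘ vlabel H) i + count (allFin n) (minusLabel s ∘ shiftLabel s ∘ vlabel H) i
      ∎
    where
    open ≡-Reasoning
    upper : ∀ v → vlabel (double s H) (v ↑ˡ n) ≡ shiftLabel s (vlabel H v)
    upper v rewrite splitAt-↑ˡ n v n = refl
    lower : ∀ v → vlabel (double s H) (n ↑ʳ v) ≡ minusLabel s (shiftLabel s (vlabel H v))
    lower v rewrite splitAt-↑ʳ n n v = refl

  edgeCount-double : ∀ i → edgeCount (double s H) i ≡
    (count (edges H) (shiftLabel s ∘ edgeLabel) i + count (edges H) (shiftLabel s ∘ edgeLabel) i)
      + count (newEdgeSources s H) (λ _ → s) i
  edgeCount-double i = begin
    count (map _ (edges H) ++ map _ (edges H) ++ map _ L) edgeLabel i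
      ≡⟨ count-++ (map _ (edges H)) _ ⟩
    count (map _ (edges H)) edgeLabel i + count (map _ (edges H) ++ map _ L) edgeLabel i
      ≡⟨ cong (count (map _ (edges H)) edgeLabel i +_) (count-++ (map _ (edges H)) _) ⟩
    count (map _ (edges H)) edgeLabel i + (count (map _ (edges H)) edgeLabel i + count (map _ L) edgeLabel i)
      ≡⟨ sym (+-assoc (count (map _ (edges H)) edgeLabel i) _ _) ⟩
    (count (map _ (edges H)) edgeLabel i + count (map _ (edges H)) edgeLabel i) + count (map _ L) edgeLabel i
      ≡⟨ cong₂ _+_ (cong₂ _+_ (count-map _ (edges H)) (count-map _ (edges H))) (count-map _ L) ⟩
    (count (edges H) (shiftLabel s ∘ edgeLabel) i + count (edges H) (shiftLabel s ∘ edgeLabel) i)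
      + count L (λ _ → s) i
      ∎
    where
    open ≡-Reasoning
    L : List (Fin n)
    L = newEdgeSources s H

  newEdges-count : length (newEdgeSources s H) ≡ vertexCount H s
  newEdges-count = count-fibre (allFin n) (shift-fibre-above ≤-refl)

pow2-double : ∀ {m} → IsPowerOf2 m → IsPowerOf2 (m + m)
pow2-double (k , refl) = suc k , cong (2 ^ k +_) (sym (+-identityʳ (2 ^ k)))

pow2-+0 : ∀ {m} → IsPowerOf2 m → IsPowerOf2 (m + 0)
pow2-+0 {m} = subst IsPowerOf2 (sym (+-identityʳ m))

pow2-≡ : ∀ {m m′} → m ≡ m′ → IsPowerOf2 m′ → IsPowerOf2 m
pow2-≡ m≡m′ = subst IsPowerOf2 (sym m≡m′)

PowerCounts : LGraph → ℕ → Set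
PowerCounts G t = ((i : ℕ) → 1 ≤ i → i ≤ suc t → IsPowerOf2 (vertexCount G i))
                × ((i : ℕ) → 1 ≤ i → i ≤ t → IsPowerOf2 (edgeCount G i))

data Position (s : ℕ) : ℕ → Set where
  below     : i < s → Position s i
  at        : Position s s
  justAbove : Position s (suc s)
  farAbove  : s < j → Position s (suc j)

position : ∀ s i → Position s i
position s i with <-cmp i s
... | tri< i<s _ _ = below i<s
... | tri≈ _ refl _ = at
position s (suc j) | tri> _ _ (s≤s s≤j) with m≤n⇒m<n∨m≡n s≤j
... | inj₁ s<j = farAbove s<j
... | inj₂ refl = justAbove

module _ {t s : ℕ} (H : LGraph) (1≤s : 1 ≤ s) (s≤t+1 : s ≤ suc t) where

  double-vertexPowers : ((i : ℕ) → 1 ≤ i → i ≤ suc t → IsPowerOf2 (vertexCount H i)) →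
    (i : ℕ) → 1 ≤ i → i ≤ suc (suc t) → IsPowerOf2 (vertexCount (double s H) i)
  double-vertexPowers vertices i 1≤i i≤t+2 with position s i
  ... | below i<s = pow2-≡ (trans (vertexCount-double s H i)
          (cong₂ _+_ (count-fibre (allFin (nV H)) (shift-fibre-below i<s))
                     (count-fibre (allFin (nV H)) (fibre-∘ (minus-fibre-fixed (<⇒≢ i<s) (<⇒≢ (m<n⇒m<1+n i<s))) (shift-fibre-below i<s)))))
          (pow2-double (vertices i 1≤i (≤-trans (<⇒≤ i<s) s≤t+1)))
  ... | at = pow2-≡ (trans (vertexCount-double s H s)
          (cong₂ _+_ (count-missed (allFin (nV H)) (shift-missed s)) (count-fibre (allFin (nV H)) (lower-fibre-at s))))
          (vertices s 1≤s s≤t+1)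
  ... | justAbove = pow2-≡ (trans (vertexCount-double s H (suc s))
          (cong₂ _+_ (count-fibre (allFin (nV H)) (shift-fibre-above ≤-refl))
                     (count-missed (allFin (nV H)) (λ y → minus-missed s (shiftLabel s y)))))
          (pow2-+0 (vertices s 1≤s s≤t+1))
  ... | farAbove {j} s<j = pow2-≡ (trans (vertexCount-double s H (suc j))
          (cong₂ _+_ (count-fibre (allFin (nV H)) (shift-fibre-above (<⇒≤ s<j)))
                     (count-fibre (allFin (nV H)) (fibre-∘ (minus-fibre-fixed j+1≢s j+1≢s+1) (shift-fibre-above (<⇒≤ s<j))))))
          (pow2-double (vertices j (≤-trans 1≤s (<⇒≤ s<j)) (≤-pred i≤t+2)))
    where
    j+1≢s : ¬ suc j ≡ s
    j+1≢s e = <-irrefl (sym e) (m<n⇒m<1+n s<j)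
    j+1≢s+1 : ¬ suc j ≡ suc s
    j+1≢s+1 e = <-irrefl (sym (suc-injective e)) s<j

  -- away from s, the new edges do not contribute and both copies carry the
  -- shifted edge labels, so the count of label i doubles that of its preimage a
  edges-away : ∀ {a} → ¬ i ≡ s → Fibre (shiftLabel s) i a → edgeCount (double s H) i ≡ edgeCount H a + edgeCount H a + 0
  edges-away {i} i≢s fibre = trans (edgeCount-double s H i)
    (cong₂ _+_ (cong₂ _+_ (count-fibre (edges H) fibre) (count-fibre (edges H) fibre))
               (count-none (newEdgeSources s H) (λ _ s≡i → i≢s (sym s≡i))))

  double-edgePowers : ((i : ℕ) → 1 ≤ i → i ≤ suc t → IsPowerOf2 (vertexCount H i)) →
    ((i : ℕ) → 1 ≤ i → i ≤ t → IsPowerOf2 (edgeCount H i)) →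
    (i : ℕ) → 1 ≤ i → i ≤ suc t → IsPowerOf2 (edgeCount (double s H) i)
  double-edgePowers vertices edges′ i 1≤i i≤t+1 with position s i
  ... | below i<s = pow2-≡ (edges-away (<⇒≢ i<s) (shift-fibre-below i<s))
          (pow2-+0 (pow2-double (edges′ i 1≤i (≤-pred (<-≤-trans i<s s≤t+1)))))
  ... | at = pow2-≡ (trans (edgeCount-double s H s)
          (cong₂ _+_ (cong₂ _+_ (count-missed (edges H) (shift-missed s)) (count-missed (edges H) (shift-missed s)))
                     (trans (count-all (newEdgeSources s H) (λ _ → refl)) (newEdges-count s H))))
          (vertices s 1≤s s≤t+1)
  ... | justAbove = pow2-≡ (edges-away (λ e → <-irrefl (sym e) ≤-refl) (shift-fibre-above ≤-refl))
          (pow2-+0 (pow2-double (edges′ s 1≤s (≤-pred i≤t+1))))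
  ... | farAbove {j} s<j = pow2-≡ (edges-away (λ e → <-irrefl (sym e) (m<n⇒m<1+n s<j)) (shift-fibre-above (<⇒≤ s<j)))
          (pow2-+0 (pow2-double (edges′ j (≤-trans 1≤s (<⇒≤ s<j)) (≤-pred i≤t+1))))

  double-powerCounts : PowerCounts H t → PowerCounts (double s H) (suc t)
  double-powerCounts (vertices , edges′) =
    double-vertexPowers vertices , double-edgePowers vertices edges′

lemma6p3 : (t : ℕ) → (c : LinOrder (suc t)) →
    ((i : ℕ) → 1 ≤ i → i ≤ suc (suc t) → IsPowerOf2 (vertexCount (𝒢 t c) i))
    × ((i : ℕ) → 1 ≤ i → i ≤ suc t → IsPowerOf2 (edgeCount (𝒢 t c) i))
lemma6p3 zero c = vertices , edges′
  where
  vertices : (i : ℕ) → 1 ≤ i → i ≤ 2 → IsPowerOf2 (vertexCount (𝒢 zero c) i)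
  vertices 1 _ _ = 0 , refl
  vertices 2 _ _ = 0 , refl
  vertices (suc (suc (suc _))) _ (s≤s (s≤s ()))
  edges′ : (i : ℕ) → 1 ≤ i → i ≤ 1 → IsPowerOf2 (edgeCount (𝒢 zero c) i)
  edges′ 1 _ _ = 0 , refl
  edges′ (suc (suc _)) _ (s≤s ())
lemma6p3 (suc t) c =
  double-powerCounts (𝒢 t (remove s c)) (s≤s z≤n) (s≤s (≤-pred (toℕ<n s))) (lemma6p3 t (remove s c))
  where
  s : Fin (suc (suc t))
  s = c ⟨$⟩ˡ fromℕ (suc t)
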